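{- Let $F$ be a forest and $\{M_i\}_{i\in F}$ a collection of MTL-chains sharing the same top element $1$. Then $F$ is totally ordered if and only if the forest product $\bigotimes_{i\in F}M_i$ is an MTL-chain.
   Context: A forest is a poset in which every $\downarrow a$ is totally ordered. MTL-chains are totally ordered bounded integral commutative prelinear residuated lattices. The forest product $\bigotimes_{i\in F}M_i$ is the set of functions $h$ on $F$ with $h(i)\in M_i$ such that for all $i$, $h(i)\ne0_i$ implies $h(j)=1$ for all $j<i$; monoid and lattice operations are pointwise, and $(h\to g)(i)=h(i)\to_ig(i)$ if $h(j)\le_jg(j)$ for all $j<i$, and $0_i$ otherwise. It is an MTL-algebra. -}

module Defs where

open import Level using (Level; _⊔_; Lift; lift; lower) renaming (suc to lsuc)
open import Data.Product using (Σ; _×_; _,_; proj₁; proj₂)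
open import Data.Sum using (_⊎_; inj₁; inj₂)
open import Data.Empty using (⊥-elim)
open import Relation.Nullary using (¬_; Dec; yes; no)
open import Relation.Nullary.Decidable using (map′)
open import Relation.Binary.Core using (Rel)
open import Relation.Binary.Definitions using (Total)
open import Relation.Binary.Structures using (IsPartialOrder; IsEquivalence)
open import Relation.Binary.PropositionalEquality using (_≡_; _≢_; refl)
open import Algebra.Core using (Op₂)
open import Algebra.Structures using (IsCommutativeMonoid)
open import Algebra.Lattice.Structures using (IsLattice)
open import Axiom.ExcludedMiddle using (ExcludedMiddle)

IsForest : ∀ {f r} {F : Set f} → Rel F r → Set (f ⊔ r)
IsForest _≤_ = ∀ a x y → x ≤ a → y ≤ a → (x ≤ y) ⊎ (y ≤ x)

Strict : ∀ {f r} {F : Set f} → Rel F r → Rel F (f ⊔ r)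
Strict _≤_ j i = (j ≤ i) × (j ≢ i)

record RawMTL (a ℓ : Level) : Set (lsuc (a ⊔ ℓ)) where
  infix  4 _≈_ _≤_
  infixr 6 _∨_
  infixr 7 _∧_
  infixr 5 _⇒_
  infixl 8 _⊙_
  field
    Carrier : Set a
    _≈_     : Rel Carrier ℓ
    _∧_     : Op₂ Carrier
    _∨_     : Op₂ Carrier
    _⊙_     : Op₂ Carrier
    _⇒_     : Op₂ Carrier
    0#      : Carrier
    1#      : Carrier

  _≤_ : Rel Carrier ℓ
  x ≤ y = (x ∧ y) ≈ x

record IsMTLAlgebra {a ℓ} (R : RawMTL a ℓ) : Set (a ⊔ ℓ) where
  open RawMTL R
  field
    isLattice             : IsLattice _≈_ _∨_ _∧_
    ⊙-isCommutativeMonoid : IsCommutativeMonoid _≈_ _⊙_ 1#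
    ⇒-cong                : ∀ {x y u v} → x ≈ y → u ≈ v → (x ⇒ u) ≈ (y ⇒ v)
    residuation           : ∀ x y z → (x ⊙ y ≤ z → x ≤ y ⇒ z) × (x ≤ y ⇒ z → x ⊙ y ≤ z)
    bottom                : ∀ x → 0# ≤ x
    integral              : ∀ x → x ≤ 1#
    prelinear             : ∀ x y → ((x ⇒ y) ∨ (y ⇒ x)) ≈ 1#

record IsMTLChain {a ℓ} (R : RawMTL a ℓ) : Set (a ⊔ ℓ) where
  open RawMTL R
  field
    isMTLAlgebra : IsMTLAlgebra R
    total        : Total _≤_

record MTLChain (a ℓ : Level) : Set (lsuc (a ⊔ ℓ)) where
  field
    raw        : RawMTL a ℓ
    isMTLChain : IsMTLChain raw
  open RawMTL raw public
  open IsMTLChain isMTLChain public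
  open IsMTLAlgebra isMTLAlgebra public
  open IsLattice isLattice public
  open IsCommutativeMonoid ⊙-isCommutativeMonoid public using () renaming (comm to ⊙-comm)

module MTLFacts {a ℓ} (M : MTLChain a ℓ) where
  open MTLChain M
  open IsLattice isLattice using ()
    renaming (refl to ≈-refl; sym to ≈-sym; trans to ≈-trans)
  open IsCommutativeMonoid ⊙-isCommutativeMonoid using (∙-cong; identityˡ)

  meet-zero : ∀ {x} y → x ≈ 0# → (x ∧ y) ≈ 0#
  meet-zero y p = ≈-trans (∧-cong p ≈-refl) (bottom y)

  meet-one : ∀ {x y} → x ≈ 1# → y ≈ 1# → (x ∧ y) ≈ 1#
  meet-one p q = ≈-trans (∧-cong p q) (integral 1#)

  join-zero : ∀ {x y} → x ≈ 0# → y ≈ 0# → (x ∨ y) ≈ 0#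
  join-zero p q = ≈-trans (∨-cong p q)
    (≈-trans (∨-cong ≈-refl (≈-sym (bottom 0#))) (proj₁ absorptive 0# 0#))

  join-oneˡ : ∀ {x} y → x ≈ 1# → (x ∨ y) ≈ 1#
  join-oneˡ y p = ≈-trans (∨-cong p ≈-refl)
    (≈-trans (∨-cong ≈-refl (≈-sym (≈-trans (∧-comm 1# y) (integral y))))
             (proj₁ absorptive 1# y))

  join-oneʳ : ∀ x {y} → y ≈ 1# → (x ∨ y) ≈ 1#
  join-oneʳ x p = ≈-trans (∨-comm x _) (join-oneˡ x p)

  zero-prod : ∀ y → (0# ⊙ y) ≈ 0#
  zero-prod y = ≈-trans (≈-sym le) (≈-trans (∧-comm _ _) (bottom _))
    where le : (0# ⊙ y) ∧ 0# ≈ 0# ⊙ y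
          le = proj₂ (residuation 0# y 0#) (bottom (y ⇒ 0#))

  prod-zero : ∀ {x} y → x ≈ 0# → (x ⊙ y) ≈ 0#
  prod-zero y p = ≈-trans (∙-cong p ≈-refl) (zero-prod y)

  prod-one : ∀ {x y} → x ≈ 1# → y ≈ 1# → (x ⊙ y) ≈ 1#
  prod-one p q = ≈-trans (∙-cong p q) (identityˡ 1#)

  imp-one : ∀ {x y} → x ≤ y → (x ⇒ y) ≈ 1#
  imp-one {x} {y} p =
    ≈-trans (≈-sym (integral (x ⇒ y))) (≈-trans (∧-comm _ _) one≤)
    where le : 1# ⊙ x ≤ y
          le = ≈-trans (∧-cong (identityˡ x) ≈-refl) (≈-trans p (≈-sym (identityˡ x)))
          one≤ : 1# ≤ x ⇒ y
          one≤ = proj₁ (residuation 1# x y) le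

-- The forest product ⨂_{i∈F} M_i.
-- Classical reasoning (the case distinction in the definition of ⇒) is
-- supplied by an excluded-middle oracle `lem`.

module ForestProduct
  {f r a ℓ} (lem : ExcludedMiddle (f ⊔ r ⊔ a ⊔ ℓ))
  (F : Set f) (_≤F_ : Rel F r) (po : IsPartialOrder _≡_ _≤F_)
  (M : F → MTLChain a ℓ) where

  open MTLChain using (Carrier; _≈_; _∧_; _∨_; _⊙_; _⇒_; 0#; 1#; _≤_)
  module M (i : F) = MTLChain (M i)
  module Fa (i : F) = MTLFacts (M i)
  module PO = IsPartialOrder po

  _<F_ : Rel F (f ⊔ r)
  _<F_ = Strict _≤F_

  <-trans : ∀ {k j i} → k <F j → j <F i → k <F i
  <-trans (k≤j , k≢j) (j≤i , j≢i) =
    PO.trans k≤j j≤i , λ { refl → j≢i (PO.antisym j≤i k≤j) }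

  Fun : Set (f ⊔ a)
  Fun = (i : F) → Carrier (M i)

  IsForestFun : Fun → Set (f ⊔ r ⊔ ℓ)
  IsForestFun h = ∀ i → ¬ (_≈_ (M i) (h i) (0# (M i))) →
                  ∀ j → j <F i → _≈_ (M j) (h j) (1# (M j))

  Elem : Set (f ⊔ r ⊔ a ⊔ ℓ)
  Elem = Σ Fun IsForestFun

  _≈P_ : Rel Elem (f ⊔ ℓ)
  (h , _) ≈P (g , _) = ∀ i → _≈_ (M i) (h i) (g i)

  decEq : ∀ i (x y : Carrier (M i)) → Dec (_≈_ (M i) x y)
  decEq i x y = map′ lower lift (lem {Lift (f ⊔ r ⊔ a ⊔ ℓ) (_≈_ (M i) x y)})

  0P : Elem
  0P = (λ i → 0# (M i)) , λ i ¬0 → ⊥-elim (¬0 (M.refl i))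

  1P : Elem
  1P = (λ i → 1# (M i)) , λ i _ j _ → M.refl j

  _∧P_ : Op₂ Elem
  (h , ph) ∧P (g , pg) = (λ i → _∧_ (M i) (h i) (g i)) , pf
    where
      pf : IsForestFun (λ i → _∧_ (M i) (h i) (g i))
      pf i ¬0 j j<i with decEq i (h i) (0# (M i))
      ... | yes h0 = ⊥-elim (¬0 (Fa.meet-zero i (g i) h0))
      ... | no h≠0 with decEq i (g i) (0# (M i))
      ...   | yes g0 = ⊥-elim (¬0 (M.trans i (M.∧-comm i _ _) (Fa.meet-zero i (h i) g0)))
      ...   | no g≠0 = Fa.meet-one j (ph i h≠0 j j<i) (pg i g≠0 j j<i)

  _∨P_ : Op₂ Elem
  (h , ph) ∨P (g , pg) = (λ i → _∨_ (M i) (h i) (g i)) , pf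
    where
      pf : IsForestFun (λ i → _∨_ (M i) (h i) (g i))
      pf i ¬0 j j<i with decEq i (h i) (0# (M i))
      ... | no h≠0 = Fa.join-oneˡ j (g j) (ph i h≠0 j j<i)
      ... | yes h0 with decEq i (g i) (0# (M i))
      ...   | yes g0 = ⊥-elim (¬0 (Fa.join-zero i h0 g0))
      ...   | no g≠0 = Fa.join-oneʳ j (h j) (pg i g≠0 j j<i)

  _⊙P_ : Op₂ Elem
  (h , ph) ⊙P (g , pg) = (λ i → _⊙_ (M i) (h i) (g i)) , pf
    where
      pf : IsForestFun (λ i → _⊙_ (M i) (h i) (g i))
      pf i ¬0 j j<i with decEq i (h i) (0# (M i))
      ... | yes h0 = ⊥-elim (¬0 (Fa.prod-zero i (g i) h0))
      ... | no h≠0 with decEq i (g i) (0# (M i))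
      ...   | yes g0 = ⊥-elim (¬0 (M.trans i (M.⊙-comm i _ _) (Fa.prod-zero i (h i) g0)))
      ...   | no g≠0 = Fa.prod-one j (ph i h≠0 j j<i) (pg i g≠0 j j<i)

  -- (h ⇒ g)(i) = h(i) ⇒ᵢ g(i) if h(j) ≤ⱼ g(j) for all j < i, and 0ᵢ otherwise
  BelowLe : Fun → Fun → F → Set (f ⊔ r ⊔ ℓ)
  BelowLe h g i = ∀ j → j <F i → _≤_ (M j) (h j) (g j)

  decBelow : ∀ h g i → Dec (BelowLe h g i)
  decBelow h g i = map′ lower lift (lem {Lift (f ⊔ r ⊔ a ⊔ ℓ) (BelowLe h g i)})

  impAt : ∀ (h g : Fun) i → Dec (BelowLe h g i) → Carrier (M i)
  impAt h g i (yes _) = _⇒_ (M i) (h i) (g i)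
  impAt h g i (no _)  = 0# (M i)

  impFun : Fun → Fun → Fun
  impFun h g i = impAt h g i (decBelow h g i)

  _⇒P_ : Op₂ Elem
  (h , _) ⇒P (g , _) = impFun h g , pf
    where
      pf : IsForestFun (impFun h g)
      pf i ¬0 j j<i with decBelow h g i
      ... | no _ = ⊥-elim (¬0 (M.refl i))
      ... | yes below with decBelow h g j
      ...   | yes _ = Fa.imp-one j (below j j<i)
      ...   | no nb = ⊥-elim (nb (λ k k<j → below k (<-trans k<j j<i)))

  product : RawMTL (f ⊔ r ⊔ a ⊔ ℓ) (f ⊔ ℓ)
  product = record
    { Carrier = Elem ; _≈_ = _≈P_ ; _∧_ = _∧P_ ; _∨_ = _∨P_
    ; _⊙_ = _⊙P_ ; _⇒_ = _⇒P_ ; 0# = 0P ; 1# = 1P }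

module Submission where

-- In a forest all
--    k < i are comparable with any j < i, which settles the case where
--    (x ⇒ y)(i) is forced to 0.
--  * If F is total, the flip lemma makes any two elements comparable.
--  * Conversely, the indicator function of a down-set ↓i is an element of
--    the product; for incomparable i, j the indicators of ↓i and ↓j are
--    incomparable, as their components at i and j would force 0 = 1.

open import Defs
open import Level using (_⊔_; Lift; lift; lower)
open import Relation.Nullary using (¬_; Dec; yes; no)
open import Relation.Nullary.Decidable using (map′)
open import Relation.Binary.Core using (Rel)
open import Relation.Binary.Definitions using (Total)
open import Relation.Binary.Structures using (IsPartialOrder)
open import Relation.Binary.PropositionalEquality using (_≡_; refl)
open import Function.Bundles using (_⇔_; mk⇔)
open import Axiom.ExcludedMiddle using (ExcludedMiddle)
open import Data.Product using (∃; _×_; _,_; proj₁; proj₂)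
open import Data.Sum using (_⊎_; inj₁; inj₂) renaming (map to ⊎-map)
open import Data.Empty using (⊥-elim)
open import Algebra.Structures using (IsCommutativeMonoid)
open import Algebra.Lattice.Structures using (IsLattice)

decide : ∀ {p q} → ExcludedMiddle (p ⊔ q) → (P : Set p) → Dec P
decide {q = q} lem P = map′ lower lift (lem {Lift q P})

¬∀⇒∃¬ : ∀ {a p q} {A : Set a} (P : A → Set p) → ExcludedMiddle (a ⊔ p ⊔ q) →
        ¬ (∀ x → P x) → ∃ λ x → ¬ P x
¬∀⇒∃¬ {a} {q = q} P lem ¬∀ with decide {q = q} lem (∃ λ x → ¬ P x)
... | yes counterexample = counterexample
... | no  none           = ⊥-elim (¬∀ holds)
  where
    holds : ∀ x → P x
    holds x with decide {q = a ⊔ q} lem (P x)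
    ... | yes px = px
    ... | no ¬px = ⊥-elim (none (x , ¬px))

¬→⇒×¬ : ∀ {p q r} {A : Set p} {B : Set q} → ExcludedMiddle (p ⊔ r) →
        ¬ (A → B) → A × ¬ B
¬→⇒×¬ {r = r} {A} lem ¬imp with decide {q = r} lem A
... | yes a = a , λ b → ¬imp (λ _ → b)
... | no ¬a = ⊥-elim (¬imp (λ a → ⊥-elim (¬a a)))

module AlgebraFacts {a ℓ} {R : RawMTL a ℓ} (alg : IsMTLAlgebra R) where
  open RawMTL R
  open IsMTLAlgebra alg
  open IsLattice isLattice using (∧-cong; ∧-comm)
    renaming (refl to ≈-refl; sym to ≈-sym; trans to ≈-trans)
  open IsCommutativeMonoid ⊙-isCommutativeMonoid using (∙-cong; identityˡ)

  ≤-resp-≈ : ∀ {x y x′ y′} → x ≈ x′ → y ≈ y′ → x ≤ y → x′ ≤ y′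
  ≤-resp-≈ x≈x′ y≈y′ x≤y = ≈-trans (∧-cong (≈-sym x≈x′) (≈-sym y≈y′)) (≈-trans x≤y x≈x′)

  ≤-one : ∀ {x y} → y ≈ 1# → x ≤ y
  ≤-one {x} y≈1 = ≈-trans (∧-cong ≈-refl y≈1) (integral x)

  zero-≤ : ∀ {x y} → x ≈ 0# → x ≤ y
  zero-≤ {y = y} x≈0 = ≈-trans (∧-cong x≈0 ≈-refl) (≈-trans (bottom y) (≈-sym x≈0))

  ≤-zero : ∀ {x} → x ≤ 0# → x ≈ 0#
  ≤-zero {x} x≤0 = ≈-trans (≈-sym x≤0) (≈-trans (∧-comm _ _) (bottom x))

  one-≤ : ∀ {y} → 1# ≤ y → y ≈ 1#
  one-≤ {y} 1≤y = ≈-trans (≈-sym (≈-trans (∧-comm _ _) (integral y))) 1≤y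

  one-⊙ : ∀ {x y} → x ≈ 1# → (x ⊙ y) ≈ y
  one-⊙ {y = y} x≈1 = ≈-trans (∙-cong x≈1 ≈-refl) (identityˡ y)

module Product {f r a ℓ} (lem : ExcludedMiddle (f ⊔ r ⊔ a ⊔ ℓ))
    (F : Set f) (_≤F_ : Rel F r) (po : IsPartialOrder _≡_ _≤F_)
    (M : F → MTLChain a ℓ) where

  open ForestProduct lem F _≤F_ po M
  open MTLChain using (_≈_; _⊙_; 0#; 1#; _≤_)
  module CM (i : F) = IsCommutativeMonoid (M.⊙-isCommutativeMonoid i)
  module AF (i : F) = AlgebraFacts (M.isMTLAlgebra i)

  P : RawMTL (f ⊔ r ⊔ a ⊔ ℓ) (f ⊔ ℓ)
  P = product

  infix 4 _≤P_
  _≤P_ : Rel Elem (f ⊔ ℓ)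
  _≤P_ = RawMTL._≤_ P

  isLatticeP : IsLattice _≈P_ _∨P_ _∧P_
  isLatticeP = record
    { isEquivalence = record
        { refl  = λ i → M.refl i
        ; sym   = λ p i → M.sym i (p i)
        ; trans = λ p q i → M.trans i (p i) (q i) }
    ; ∨-comm     = λ _ _ i → M.∨-comm i _ _
    ; ∨-assoc    = λ _ _ _ i → M.∨-assoc i _ _ _
    ; ∨-cong     = λ p q i → M.∨-cong i (p i) (q i)
    ; ∧-comm     = λ _ _ i → M.∧-comm i _ _
    ; ∧-assoc    = λ _ _ _ i → M.∧-assoc i _ _ _
    ; ∧-cong     = λ p q i → M.∧-cong i (p i) (q i)
    ; absorptive = (λ _ _ i → proj₁ (M.absorptive i) _ _)
                 , (λ _ _ i → proj₂ (M.absorptive i) _ _)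
    }

  ⊙-isCommutativeMonoidP : IsCommutativeMonoid _≈P_ _⊙P_ 1P
  ⊙-isCommutativeMonoidP = record
    { isMonoid = record
      { isSemigroup = record
        { isMagma = record
          { isEquivalence = IsLattice.isEquivalence isLatticeP
          ; ∙-cong        = λ p q i → CM.∙-cong i (p i) (q i) }
        ; assoc = λ _ _ _ i → CM.assoc i _ _ _ }
      ; identity = (λ _ i → CM.identityˡ i _) , (λ _ i → CM.identityʳ i _) }
    ; comm = λ _ _ i → CM.comm i _ _ }

  BelowLe-resp : ∀ {h h′ g g′ : Fun} i →
                 (∀ j → _≈_ (M j) (h j) (h′ j)) → (∀ j → _≈_ (M j) (g j) (g′ j)) →
                 BelowLe h g i → BelowLe h′ g′ i
  BelowLe-resp i h≈h′ g≈g′ below j j<i = AF.≤-resp-≈ j (h≈h′ j) (g≈g′ j) (below j j<i)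

  ⇒-congP : ∀ {x y u v} → x ≈P y → u ≈P v → (x ⇒P u) ≈P (y ⇒P v)
  ⇒-congP {x , _} {y , _} {u , _} {v , _} x≈y u≈v i
    with decBelow x u i | decBelow y v i
  ... | yes _ | yes _  = M.⇒-cong i (x≈y i) (u≈v i)
  ... | no _  | no _   = M.refl i
  ... | yes b | no ¬b  = ⊥-elim (¬b (BelowLe-resp i x≈y u≈v b))
  ... | no ¬b | yes b  =
    ⊥-elim (¬b (BelowLe-resp i (λ j → M.sym j (x≈y j)) (λ j → M.sym j (u≈v j)) b))

  -- Residuation: where (y ⇒ z)(i) is forced to 0, any x ≤ y ⇒ z vanishes at i,
  -- while x ⊙ y ≤ z forces x(i) = 0 because otherwise x = 1 below i.
  residuationP : ∀ x y z → ((x ⊙P y) ≤P z → x ≤P (y ⇒P z)) × (x ≤P (y ⇒P z) → (x ⊙P y) ≤P z)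
  residuationP (x , x-forest) (y , _) (z , _) = adjoint , unadjoint
    where
      adjoint : (∀ i → _≤_ (M i) (_⊙_ (M i) (x i) (y i)) (z i)) → ∀ i → _≤_ (M i) (x i) (impFun y z i)
      adjoint xy≤z i with decBelow y z i
      ... | yes _ = proj₁ (M.residuation i (x i) (y i) (z i)) (xy≤z i)
      ... | no ¬b with decEq i (x i) (0# (M i))
      ...   | yes x≈0 = AF.zero-≤ i x≈0
      ...   | no  x≉0 = ⊥-elim (¬b λ j j<i →
                AF.≤-resp-≈ j (AF.one-⊙ j (x-forest i x≉0 j j<i)) (M.refl j) (xy≤z j))
      unadjoint : (∀ i → _≤_ (M i) (x i) (impFun y z i)) → ∀ i → _≤_ (M i) (_⊙_ (M i) (x i) (y i)) (z i)
      unadjoint x≤y⇒z i with decBelow y z i | x≤y⇒z i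
      ... | yes _ | x≤ = proj₂ (M.residuation i (x i) (y i) (z i)) x≤
      ... | no _  | x≤ = AF.zero-≤ i (Fa.prod-zero i (y i) (AF.≤-zero i x≤))

  -- Flip lemma: a failure x(i) ≰ y(i) forces y ≤ x at every index comparable
  -- with i.  Below i, x is 1 (as x(i) ≠ 0); above i, y is 0 (as y(i) ≠ 1).
  flip : (x y : Elem) (i : F) → ¬ (_≤_ (M i) (proj₁ x i) (proj₁ y i)) →
         ∀ k → k ≤F i ⊎ i ≤F k → _≤_ (M k) (proj₁ y k) (proj₁ x k)
  flip (x , x-forest) (y , y-forest) i x≰y k _ with decide {q = r ⊔ a ⊔ ℓ} lem (k ≡ i)
  ... | yes refl with M.total i (x i) (y i)
  ...   | inj₁ x≤y = ⊥-elim (x≰y x≤y)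
  ...   | inj₂ y≤x = y≤x
  flip (x , x-forest) (y , _) i x≰y k (inj₁ k≤i) | no k≢i =
    AF.≤-one k (x-forest i (λ x≈0 → x≰y (AF.zero-≤ i x≈0)) k (k≤i , k≢i))
  flip (x , _) (y , y-forest) i x≰y k (inj₂ i≤k) | no k≢i with decEq k (y k) (0# (M k))
  ... | yes y≈0 = AF.zero-≤ k y≈0
  ... | no  y≉0 = ⊥-elim (x≰y (AF.≤-one i (y-forest k y≉0 i (i≤k , λ { refl → k≢i refl }))))

  impAt-one : ∀ (x y : Fun) i → BelowLe x y i → _≤_ (M i) (x i) (y i) →
              (d : Dec (BelowLe x y i)) → _≈_ (M i) (impAt x y i d) (1# (M i))
  impAt-one x y i _     x≤y (yes _) = Fa.imp-one i x≤y
  impAt-one x y i below _   (no ¬b) = ⊥-elim (¬b below)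

  -- If x ⇒ y fails its side condition at i, then (y ⇒ x)(i) = 1: a witness
  -- j < i of x(j) ≰ y(j) is comparable with i and, in a forest, with all k < i.
  imp-converse-one : IsForest _≤F_ → (x y : Elem) (i : F) →
                     ¬ BelowLe (proj₁ x) (proj₁ y) i →
                     BelowLe (proj₁ y) (proj₁ x) i × _≤_ (M i) (proj₁ y i) (proj₁ x i)
  imp-converse-one forest x y i ¬below
    with ¬∀⇒∃¬ {q = a} (λ j → j <F i → _≤_ (M j) (proj₁ x j) (proj₁ y j)) lem ¬below
  ... | j , ¬below-j with ¬→⇒×¬ {r = f ⊔ a ⊔ ℓ} lem ¬below-j
  ...   | (j≤i , _) , xj≰yj =
    (λ k k<i → flip x y j xj≰yj k (forest i k j (proj₁ k<i) j≤i)) , flip x y j xj≰yj i (inj₂ j≤i)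

  prelinearP : IsForest _≤F_ → ∀ x y → ((x ⇒P y) ∨P (y ⇒P x)) ≈P 1P
  prelinearP forest (x , px) (y , py) i with decBelow x y i | decBelow y x i
  ... | yes _ | yes _ = M.prelinear i (x i) (y i)
  ... | no ¬b | d =
    let (below , y≤x) = imp-converse-one forest (x , px) (y , py) i ¬b
    in Fa.join-oneʳ i _ (impAt-one y x i below y≤x d)
  ... | yes b | no ¬b =
    let (_ , x≤y) = imp-converse-one forest (y , py) (x , px) i ¬b
    in Fa.join-oneˡ i _ (impAt-one x y i b x≤y (yes b))

  isMTLAlgebraP : IsForest _≤F_ → IsMTLAlgebra P
  isMTLAlgebraP forest = record
    { isLattice             = isLatticeP
    ; ⊙-isCommutativeMonoid = ⊙-isCommutativeMonoidP
    ; ⇒-cong                = λ {x} {y} {u} {v} → ⇒-congP {x} {y} {u} {v}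
    ; residuation           = residuationP
    ; bottom                = λ _ i → M.bottom i _
    ; integral              = λ _ i → M.integral i _
    ; prelinear             = prelinearP forest }

  -- Over a totally ordered index set the product order is total: a failure
  -- of x ≤ y at one index flips every component.
  totalP : Total _≤F_ → Total _≤P_
  totalP total x y with decide {q = r ⊔ a} lem (x ≤P y)
  ... | yes x≤y = inj₁ x≤y
  ... | no  x≰y =
    let (i , xi≰yi) = ¬∀⇒∃¬ {q = r ⊔ a} (λ i → _≤_ (M i) (proj₁ x i) (proj₁ y i)) lem x≰y
    in inj₂ (λ k → flip x y i xi≰yi k (total k i))

  _≤?F_ : (i j : F) → Dec (i ≤F j)
  i ≤?F j = decide {q = f ⊔ a ⊔ ℓ} lem (i ≤F j)

  indicator : F → Fun
  indicator i k with k ≤?F i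
  ... | yes _ = 1# (M k)
  ... | no  _ = 0# (M k)

  indicator-in : ∀ i k → k ≤F i → _≈_ (M k) (indicator i k) (1# (M k))
  indicator-in i k k≤i with k ≤?F i
  ... | yes _ = M.refl k
  ... | no  k≰i = ⊥-elim (k≰i k≤i)

  indicator-out : ∀ i k → ¬ (k ≤F i) → _≈_ (M k) (indicator i k) (0# (M k))
  indicator-out i k k≰i with k ≤?F i
  ... | yes k≤i = ⊥-elim (k≰i k≤i)
  ... | no  _   = M.refl k

  downSet : F → Elem
  downSet i = indicator i , forest-condition
    where
      forest-condition : IsForestFun (indicator i)
      forest-condition k nonzero j (j≤k , _) = by-cases (k ≤?F i)
        where
          by-cases : Dec (k ≤F i) → _≈_ (M j) (indicator i j) (1# (M j))
          by-cases (yes k≤i) = indicator-in i j (PO.trans j≤k k≤i)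
          by-cases (no  k≰i) = ⊥-elim (nonzero (indicator-out i k k≰i))

  -- With nontrivial components, ↓i ≤ ↓j forces i ≤ j: otherwise at index i
  -- the left side is 1 and the right side 0.
  downSet-reflects : (∀ i → ¬ (_≈_ (M i) (0# (M i)) (1# (M i)))) →
                     ∀ i j → downSet i ≤P downSet j → i ≤F j
  downSet-reflects nontrivial i j ↓i≤↓j with i ≤?F j
  ... | yes i≤j = i≤j
  ... | no  i≰j = ⊥-elim (nontrivial i (AF.one-≤ i
                    (AF.≤-resp-≈ i (indicator-in i i PO.refl) (indicator-out j i i≰j) (↓i≤↓j i))))

  total-index : (∀ i → ¬ (_≈_ (M i) (0# (M i)) (1# (M i)))) → Total _≤P_ → Total _≤F_
  total-index nontrivial total i j =
    ⊎-map (downSet-reflects nontrivial i j) (downSet-reflects nontrivial j i)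
          (total (downSet i) (downSet j))

lemma4p6 : ∀ {f r a ℓ} (lem : ExcludedMiddle (f ⊔ r ⊔ a ⊔ ℓ))
    (F : Set f) (_≤_ : Rel F r) (po : IsPartialOrder _≡_ _≤_) → IsForest _≤_ →
    (M : F → MTLChain a ℓ) →
    (∀ i → ¬ (MTLChain._≈_ (M i) (MTLChain.0# (M i)) (MTLChain.1# (M i)))) →
    (Total _≤_ ⇔ IsMTLChain (ForestProduct.product lem F _≤_ po M))
lemma4p6 lem F _≤_ po forest M nontrivial = mk⇔ chain-if-total total-if-chain
  where
    open Product lem F _≤_ po M
    chain-if-total : Total _≤_ → IsMTLChain P
    chain-if-total total = record { isMTLAlgebra = isMTLAlgebraP forest ; total = totalP total }
    total-if-chain : IsMTLChain P → Total _≤_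
    total-if-chain chain = total-index nontrivial (IsMTLChain.total chain)
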